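{- Let $G=\langle\rho,\tau\rangle$ be a group with $\tau^2=1$, let $U$ be a core-free subgroup of $G$, let $H=\langle\rho\rangle$, and let $\Gamma=\mathrm{Mon}(G;U,\rho,\tau)$. Then for every $k\in G$, the neighbourhood of the vertex $UkH$ in $\Gamma$ is \[\{\,Ug\tau H \mid g\in UkH \text{ and } g\tau\notin Ug\,\}.\]
   Context: A subgroup $U\le G$ is core-free if $\bigcap_{g\in G}g^{ -1}Ug=1$. Monodromy graph: let $G=\langle\rho,\tau\rangle$ with $\tau^2=1$, $U$ core-free in $G$, $H=\langle\rho\rangle$, and $S$ a right transversal of $U$ in $G$. The graph $\mathrm{Mon}(G;U,\rho,\tau)$ has vertex set $\{UgH\mid g\in G\}$, edge set $\{\{UhH,Uh\tau H\}\mid h\in S\}$, and for $h\in S$ the multiplicity of the edge between $UhH$ and $Uh\tau H$ is $|D|$ where $D=\{g\in S\mid g\in UhH \text{ and } g\tau\in Uh\tau H\}$. The edge $\{UhH,Uh\tau H\}$ is a free edge (an edge with only one end at a vertex) if $h\tau\in Uh$, and a loop if $h\tau\notin Uh$ but $h\tau\in UhH$. The neighbourhood of a vertex $x$ is the set of vertices $y$ joined to $x$ by an edge that is not a free edge (a loop at $x$ makes $x$ a neighbour of itself). -}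

module Defs where

open import Level using (Level; _⊔_)
open import Algebra.Bundles using (Group)
open import Data.Product using (Σ; _×_; ∃; _,_)
open import Data.Sum using (_⊎_)
open import Relation.Nullary using (¬_)

module Mon {c ℓ : Level} (G : Group c ℓ) where
  open Group G

  record IsSubgroup {u : Level} (U : Carrier → Set u) : Set (c ⊔ ℓ ⊔ u) where
    field
      resp  : ∀ {x y} → x ≈ y → U x → U y
      ε∈    : U ε
      ∙∈    : ∀ {x y} → U x → U y → U (x ∙ y)
      ⁻¹∈   : ∀ {x} → U x → U (x ⁻¹)

  data ⟨_⟩ {x : Level} (X : Carrier → Set x) : Carrier → Set (c ⊔ ℓ ⊔ x) where
    gen  : ∀ {g} → X g → ⟨ X ⟩ g
    one  : ⟨ X ⟩ ε
    mul  : ∀ {g h} → ⟨ X ⟩ g → ⟨ X ⟩ h → ⟨ X ⟩ (g ∙ h)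
    inv  : ∀ {g} → ⟨ X ⟩ g → ⟨ X ⟩ (g ⁻¹)
    resp : ∀ {g h} → g ≈ h → ⟨ X ⟩ g → ⟨ X ⟩ h

  ⟨_⟩₁ : Carrier → Carrier → Set (c ⊔ ℓ)
  ⟨ ρ ⟩₁ = ⟨ (λ x → x ≈ ρ) ⟩

  ⟨_,_⟩₂ : Carrier → Carrier → Carrier → Set (c ⊔ ℓ)
  ⟨ ρ , τ ⟩₂ = ⟨ (λ x → x ≈ ρ ⊎ x ≈ τ) ⟩

  CoreFree : {u : Level} → (Carrier → Set u) → Set (c ⊔ ℓ ⊔ u)
  CoreFree U = ∀ x → (∀ g → ∃ λ v → U v × x ≈ g ⁻¹ ∙ v ∙ g) → x ≈ ε

  _∈R_·_ : {u : Level} → Carrier → (Carrier → Set u) → Carrier → Set (c ⊔ ℓ ⊔ u)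
  a ∈R U · g = ∃ λ v → U v × a ≈ v ∙ g

  _∈D_·_·_ : {u h : Level} → Carrier → (Carrier → Set u) → Carrier → (Carrier → Set h) → Set (c ⊔ ℓ ⊔ u ⊔ h)
  a ∈D U · g · H = ∃ λ v → ∃ λ w → U v × H w × a ≈ v ∙ g ∙ w

  DCEq : {u h : Level} → (Carrier → Set u) → (Carrier → Set h) → Carrier → Carrier → Set (c ⊔ ℓ ⊔ u ⊔ h)
  DCEq U H a b = ∀ x → (x ∈D U · a · H → x ∈D U · b · H) × (x ∈D U · b · H → x ∈D U · a · H)

  IsRightTransversal : {u s : Level} → (Carrier → Set u) → (Carrier → Set s) → Set (c ⊔ ℓ ⊔ u ⊔ s)
  IsRightTransversal U S =
    (∀ g → ∃ λ s → S s × s ∈R U · g) ×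
    (∀ g s t → S s → S t → s ∈R U · g → t ∈R U · g → s ≈ t)

  -- In Mon(G;U,ρ,τ) with transversal S, the vertex U y H lies in the neighbourhood
  -- of the vertex U x H: there is an edge {U h H, U h τ H} (h ∈ S) that is not a
  -- free edge (h τ ∉ U h) having U x H as one end and U y H as the other.
  InNeighbourhood : {u s : Level} → (U : Carrier → Set u) → (S : Carrier → Set s) →
                    (ρ τ : Carrier) → (x y : Carrier) → Set (c ⊔ ℓ ⊔ u ⊔ s)
  InNeighbourhood U S ρ τ x y =
    ∃ λ h → S h × ¬ ((h ∙ τ) ∈R U · h) ×
      ((DCEq U ⟨ ρ ⟩₁ x h × DCEq U ⟨ ρ ⟩₁ y (h ∙ τ)) ⊎
       (DCEq U ⟨ ρ ⟩₁ x (h ∙ τ) × DCEq U ⟨ ρ ⟩₁ y h))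

-- An edge {U h H, U h τ H} with h τ ∉ U h is also the edge seen from h τ, since
-- (h τ) τ = h; so the neighbours of U k H are exactly the double cosets U g τ H with
-- g ∈ U k H and g τ ∉ U g. Conversely such a g is replaced by the transversal element
-- h ∈ S ∩ U g, which changes neither U g H, nor U g τ H, nor whether g τ ∈ U g.
module Submission where

open import Defs
open import Level using (Level; _⊔_)
open import Algebra.Bundles using (Group)
import Algebra.Properties.Group as GroupProperties
open import Data.Product using (_×_; ∃; _,_; proj₁; proj₂)
open import Data.Sum using (inj₁; inj₂)
open import Relation.Nullary using (¬_)
open import Function.Base using (_∘_)
open import Function.Bundles using (_⇔_; mk⇔)
import Relation.Binary.Reasoning.Setoid as SetoidReasoning

module _ {c ℓ : Level} (G : Group c ℓ) where
  open Group G
  open Mon G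
  open GroupProperties G using (\\-leftDividesʳ; //-rightDividesʳ)
  open SetoidReasoning setoid

  ⟨⟩-isSubgroup : ∀ {x} {X : Carrier → Set x} → IsSubgroup ⟨ X ⟩
  ⟨⟩-isSubgroup = record { resp = resp ; ε∈ = one ; ∙∈ = mul ; ⁻¹∈ = inv }

  ∙-cancel-involutionʳ : ∀ {t} → t ∙ t ≈ ε → ∀ a → a ∙ t ∙ t ≈ a
  ∙-cancel-involutionʳ {t} t∙t≈ε a = begin
    a ∙ t ∙ t    ≈⟨ assoc a t t ⟩
    a ∙ (t ∙ t)  ≈⟨ ∙-congˡ t∙t≈ε ⟩
    a ∙ ε        ≈⟨ identityʳ a ⟩
    a            ∎

  module RightCosets {u : Level} {U : Carrier → Set u} (U-subgroup : IsSubgroup U) where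
    open IsSubgroup U-subgroup

    ∈R-resp : ∀ {a b g} → a ≈ b → a ∈R U · g → b ∈R U · g
    ∈R-resp a≈b (v , v∈U , a≈vg) = v , v∈U , trans (sym a≈b) a≈vg

    ∈R-refl : ∀ {g} → g ∈R U · g
    ∈R-refl {g} = ε , ε∈ , sym (identityˡ g)

    ∈R-sym : ∀ {a b} → a ∈R U · b → b ∈R U · a
    ∈R-sym {a} {b} (v , v∈U , a≈vb) = v ⁻¹ , ⁻¹∈ v∈U , (begin
      b              ≈⟨ \\-leftDividesʳ v b ⟨
      v ⁻¹ ∙ (v ∙ b) ≈⟨ ∙-congˡ a≈vb ⟨
      v ⁻¹ ∙ a       ∎)

    ∈R-trans : ∀ {a b d} → a ∈R U · b → b ∈R U · d → a ∈R U · d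
    ∈R-trans {a} {b} {d} (v , v∈U , a≈vb) (w , w∈U , b≈wd) = v ∙ w , ∙∈ v∈U w∈U , (begin
      a           ≈⟨ a≈vb ⟩
      v ∙ b       ≈⟨ ∙-congˡ b≈wd ⟩
      v ∙ (w ∙ d) ≈⟨ assoc v w d ⟨
      v ∙ w ∙ d   ∎)

    ∈R-∙ʳ : ∀ {a b} t → a ∈R U · b → (a ∙ t) ∈R U · (b ∙ t)
    ∈R-∙ʳ {a} {b} t (v , v∈U , a≈vb) = v , v∈U , trans (∙-congʳ a≈vb) (assoc v b t)

    freeEdge-cong : ∀ {a b} t → a ∈R U · b → (b ∙ t) ∈R U · b → (a ∙ t) ∈R U · a
    freeEdge-cong t a∈Ub b∙t∈Ub = ∈R-trans (∈R-∙ʳ t a∈Ub) (∈R-trans b∙t∈Ub (∈R-sym a∈Ub))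

    freeEdge-flip : ∀ {t} → t ∙ t ≈ ε → ∀ a → (a ∙ t ∙ t) ∈R U · (a ∙ t) → (a ∙ t) ∈R U · a
    freeEdge-flip t∙t≈ε a = ∈R-sym ∘ ∈R-resp (∙-cancel-involutionʳ t∙t≈ε a)

  module DoubleCosets {u h : Level} {U : Carrier → Set u} {H : Carrier → Set h}
                      (U-subgroup : IsSubgroup U) (H-subgroup : IsSubgroup H) where
    open RightCosets U-subgroup using (∈R-refl)
    private
      module U = IsSubgroup U-subgroup
      module H = IsSubgroup H-subgroup

    ∈R⇒∈D : ∀ {a b} → a ∈R U · b → a ∈D U · b · H
    ∈R⇒∈D {a} {b} (v , v∈U , a≈vb) = v , ε , v∈U , H.ε∈ , trans a≈vb (sym (identityʳ (v ∙ b)))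

    ∈D-refl : ∀ {g} → g ∈D U · g · H
    ∈D-refl = ∈R⇒∈D ∈R-refl

    ∈D-trans : ∀ {x a b} → x ∈D U · a · H → a ∈D U · b · H → x ∈D U · b · H
    ∈D-trans {x} {a} {b} (v , w , v∈U , w∈H , x≈vaw) (v′ , w′ , v′∈U , w′∈H , a≈v′bw′) =
      v ∙ v′ , w′ ∙ w , U.∙∈ v∈U v′∈U , H.∙∈ w′∈H w∈H , (begin
        x                       ≈⟨ x≈vaw ⟩
        v ∙ a ∙ w               ≈⟨ ∙-congʳ (∙-congˡ a≈v′bw′) ⟩
        v ∙ (v′ ∙ b ∙ w′) ∙ w   ≈⟨ ∙-congʳ (assoc v (v′ ∙ b) w′) ⟨
        v ∙ (v′ ∙ b) ∙ w′ ∙ w   ≈⟨ assoc (v ∙ (v′ ∙ b)) w′ w ⟩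
        v ∙ (v′ ∙ b) ∙ (w′ ∙ w) ≈⟨ ∙-congʳ (assoc v v′ b) ⟨
        v ∙ v′ ∙ b ∙ (w′ ∙ w)   ∎)

    ∈D-sym : ∀ {a b} → a ∈D U · b · H → b ∈D U · a · H
    ∈D-sym {a} {b} (v , w , v∈U , w∈H , a≈vbw) = v ⁻¹ , w ⁻¹ , U.⁻¹∈ v∈U , H.⁻¹∈ w∈H , (begin
      b                           ≈⟨ //-rightDividesʳ w b ⟨
      b ∙ w ∙ w ⁻¹                ≈⟨ ∙-congʳ (\\-leftDividesʳ v (b ∙ w)) ⟨
      v ⁻¹ ∙ (v ∙ (b ∙ w)) ∙ w ⁻¹ ≈⟨ ∙-congʳ (∙-congˡ (trans a≈vbw (assoc v b w))) ⟨
      v ⁻¹ ∙ a ∙ w ⁻¹             ∎)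

    ∈D⇒DCEq : ∀ {a b} → a ∈D U · b · H → DCEq U H a b
    ∈D⇒DCEq a∈UbH x = (λ x∈UaH → ∈D-trans x∈UaH a∈UbH) , (λ x∈UbH → ∈D-trans x∈UbH (∈D-sym a∈UbH))

    DCEq⇒∈D : ∀ {a b} → DCEq U H a b → a ∈D U · b · H
    DCEq⇒∈D {a} a≡b = proj₁ (a≡b a) ∈D-refl

    DCEq-sym : ∀ {a b} → DCEq U H a b → DCEq U H b a
    DCEq-sym a≡b x = proj₂ (a≡b x) , proj₁ (a≡b x)

    DCEq-trans : ∀ {a b d} → DCEq U H a b → DCEq U H b d → DCEq U H a d
    DCEq-trans a≡b b≡d x = proj₁ (b≡d x) ∘ proj₁ (a≡b x) , proj₂ (a≡b x) ∘ proj₂ (b≡d x)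

  module Neighbourhood {u s : Level} {U : Carrier → Set u} (U-subgroup : IsSubgroup U)
                       (S : Carrier → Set s) (ρ : Carrier) {τ : Carrier} (τ∙τ≈ε : τ ∙ τ ≈ ε) where
    open RightCosets U-subgroup
    open DoubleCosets U-subgroup (⟨⟩-isSubgroup {X = λ x → x ≈ ρ})

    NeighbourByCoset : Carrier → Carrier → Set (c ⊔ ℓ ⊔ u)
    NeighbourByCoset k y =
      ∃ λ g → (g ∈D U · k · ⟨ ρ ⟩₁) × ¬ ((g ∙ τ) ∈R U · g) × DCEq U ⟨ ρ ⟩₁ y (g ∙ τ)

    InNeighbourhood⇒NeighbourByCoset : ∀ {k y} → InNeighbourhood U S ρ τ k y → NeighbourByCoset k y
    InNeighbourhood⇒NeighbourByCoset (h , _ , notFree , inj₁ (k≡h , y≡hτ)) =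
      h , DCEq⇒∈D (DCEq-sym k≡h) , notFree , y≡hτ
    InNeighbourhood⇒NeighbourByCoset (h , _ , notFree , inj₂ (k≡hτ , y≡h)) =
      h ∙ τ , DCEq⇒∈D (DCEq-sym k≡hτ) , notFree ∘ freeEdge-flip τ∙τ≈ε h , DCEq-trans y≡h h≡hττ
      where
      h≡hττ : DCEq U ⟨ ρ ⟩₁ h (h ∙ τ ∙ τ)
      h≡hττ = ∈D⇒DCEq (∈R⇒∈D (∈R-resp (∙-cancel-involutionʳ τ∙τ≈ε h) ∈R-refl))

    NeighbourByCoset⇒InNeighbourhood : (∀ g → ∃ λ h → S h × h ∈R U · g) →
                                       ∀ {k y} → NeighbourByCoset k y → InNeighbourhood U S ρ τ k y
    NeighbourByCoset⇒InNeighbourhood transversal (g , g∈UkH , notFree , y≡gτ)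
      with transversal g
    ... | h , h∈S , h∈Ug =
      h , h∈S , notFree ∘ freeEdge-cong τ (∈R-sym h∈Ug) ,
      inj₁ (DCEq-sym (∈D⇒DCEq (∈D-trans (∈R⇒∈D h∈Ug) g∈UkH)) ,
            DCEq-trans y≡gτ (DCEq-sym (∈D⇒DCEq (∈R⇒∈D (∈R-∙ʳ τ h∈Ug)))))

proposition3p5 : {c ℓ u s : Level} (G : Group c ℓ) →
    let open Group G
        open Mon G
    in (ρ τ : Carrier) → (τ ∙ τ ≈ ε) → (∀ g → ⟨ ρ , τ ⟩₂ g) →
       (U : Carrier → Set u) → IsSubgroup U → CoreFree U →
       (S : Carrier → Set s) → IsRightTransversal U S →
       (k y : Carrier) →
       InNeighbourhood U S ρ τ k y ⇔
       (∃ λ g → (g ∈D U · k · ⟨ ρ ⟩₁) × ¬ ((g ∙ τ) ∈R U · g) × DCEq U ⟨ ρ ⟩₁ y (g ∙ τ))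
proposition3p5 G ρ τ τ∙τ≈ε _ U U-subgroup _ S (transversal , _) k y =
  mk⇔ InNeighbourhood⇒NeighbourByCoset (NeighbourByCoset⇒InNeighbourhood transversal)
  where open Neighbourhood G U-subgroup S ρ τ∙τ≈ε
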